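{- Let $s\geq 4$ and $t\geq 1$ be integers and let $G$ be the threshold graph realized by the code $0^{s}1^{t}$. Then the restricted threshold dimension of $G$ is $\tau_r(G)=\lceil s/2\rceil+(t-1)$.
   Context: Threshold graph realized by a binary code $b=b_1\cdots b_n$ (with $b_1=0$): start with a single vertex $v_1$; for $i\geq 2$ add $v_i$ as an isolated vertex if $b_i=0$ and as a dominating vertex (adjacent to all previously added vertices) if $b_i=1$. The code $0^s1^t$ is $s$ zeros followed by $t$ ones. The metric dimension $\beta(H)$ of a connected graph $H$ is the minimum size of a set $\mathcal{W}$ of vertices such that every vertex is uniquely determined by its vector of distances to the vertices of $\mathcal{W}$. Threshold graphs are the $\{P_4,C_4,2K_2\}$-free graphs (equivalently the graphs realized by such codes). The restricted threshold dimension is $\tau_r(G)=\min\{\beta(H): H \text{ is a threshold graph containing } G \text{ as a spanning subgraph}\}$. -}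

module Defs where

open import Data.Nat using (ℕ; zero; suc; _<_; _≤_; _<ᵇ_; _≤ᵇ_; _+_; _∸_; ⌈_/2⌉)
open import Data.Bool using (Bool; true; false; if_then_else_)
open import Data.Fin using (Fin; toℕ)
open import Data.Fin.Subset using (Subset; _∈_; ∣_∣)
open import Data.Fin.Permutation using (Permutation′; _⟨$⟩ʳ_)
open import Data.Product using (Σ; _×_; ∃; ∃-syntax)
open import Relation.Binary.PropositionalEquality using (_≡_)
open import Relation.Nullary using (¬_)

Graph : ℕ → Set
Graph n = Fin n → Fin n → Bool

-- A binary code b = b_1 ⋯ b_n, as a function Fin n → Bool (index 0 is b_1).
Code : ℕ → Set
Code n = Fin n → Bool

-- The graph realized by a code: v_i ~ v_j (i ≠ j) iff the later-added
-- vertex (larger index) was added as a dominating vertex.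
-- (The first bit b_1 plays no role.)
codeGraph : ∀ {n} → Code n → Graph n
codeGraph b i j =
  if toℕ i <ᵇ toℕ j then b j
  else (if toℕ j <ᵇ toℕ i then b i else false)

code0s1t : (s t : ℕ) → Code (s + t)
code0s1t s t i = s ≤ᵇ toℕ i

IsThreshold : ∀ {n} → Graph n → Set
IsThreshold {n} H =
  Σ (Code n) λ b → Σ (Permutation′ n) λ σ →
    ∀ i j → H i j ≡ codeGraph b (σ ⟨$⟩ʳ i) (σ ⟨$⟩ʳ j)

SpanningSubgraph : ∀ {n} → Graph n → Graph n → Set
SpanningSubgraph G H = ∀ i j → G i j ≡ true → H i j ≡ true

data Walk {n} (H : Graph n) : Fin n → Fin n → ℕ → Set where
  here : ∀ {u} → Walk H u u zero
  step : ∀ {u v w k} → H u v ≡ true → Walk H v w k → Walk H u w (suc k)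

Dist : ∀ {n} → Graph n → Fin n → Fin n → ℕ → Set
Dist H u v k = Walk H u v k × (∀ j → j < k → ¬ Walk H u v j)

Resolving : ∀ {n} → Graph n → Subset n → Set
Resolving {n} H W =
  ∀ (u v : Fin n) →
    (∀ w → w ∈ W → ∀ k → (Dist H u w k → Dist H v w k) × (Dist H v w k → Dist H u w k)) →
    u ≡ v

RestrictedThresholdDim : ∀ {n} → Graph n → ℕ → Set
RestrictedThresholdDim {n} G m =
  (Σ (Graph n) λ H → IsThreshold H × SpanningSubgraph G H ×
     Σ (Subset n) λ W → Resolving H W × ∣ W ∣ ≡ m)
  × (∀ (H : Graph n) → IsThreshold H → SpanningSubgraph G H →
       ∀ (W : Subset n) → Resolving H W → m ≤ ∣ W ∣)

-- Upper bound: G is a spanning subgraph of the threshold graph H of the code 1010⋯ (length s)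
-- followed by 1^t.  The odd positions together with the positions beyond s resolve H: of two
-- vertices u < v outside this set, the predecessor of v is adjacent to v but not to u.
--
-- Lower bound: the set U of the last t vertices is universal in G, hence in every threshold
-- supergraph H, so distances in H are 1 or 2 and a resolving set W must separate the vertices
-- outside W by their adjacencies to W.  Neighbourhoods in a threshold graph are nested, so the
-- vertices outside W have pairwise distinct numbers of neighbours in W, all between |U ∩ W|
-- and |W|: there are at most |W| - |U ∩ W| + 1 of them.  At most one vertex of U lies outside
-- W, so t ≤ |U ∩ W| + 1; adding up, s + 2t ≤ 2|W| + 2.

module Submission where

open import Defs
open import Data.Bool using (Bool; true; false; not; _∨_)
open import Data.Bool.Properties using (∨-conicalˡ; ∨-conicalʳ; ∨-zeroʳ; not-injective)
open import Data.Empty using (⊥-elim)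
open import Data.Fin using (Fin; toℕ; fromℕ<)
open import Data.Fin.Properties using (toℕ-injective; toℕ-fromℕ<; toℕ<n)
open import Data.Fin.Permutation using (_⟨$⟩ʳ_; id)
open import Data.Fin.Subset using (Subset; _∈_; _∉_; _⊆_; _∩_; ∁; ∣_∣; ⁅_⁆; ⊥)
open import Data.Fin.Subset.Properties
  using (_∈?_; nonempty?; p⊆q⇒∣p∣≤∣q∣; p⊂q⇒∣p∣<∣q∣; ∣p∣≤n; ∣⊥∣≡0; ∣⁅x⁆∣≡1; x∈⁅x⁆; ∣∁p∣≡n∸∣p∣;
         p∩q⊆p; ∣p∩q∣≤∣q∣; x∈p∩q⁺; x∈p∩q⁻; x∈∁p⇒x∉p)
open import Data.Nat
  using (ℕ; zero; suc; _+_; _∸_; _≤_; _<_; _≤ᵇ_; _<ᵇ_; z≤n; s≤s; s≤s⁻¹; z<s; s<s; ⌈_/2⌉; ⌊_/2⌋)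
open import Data.Nat.Properties
  using (_≟_; <-cmp; ≤-reflexive; ≤-trans; <-trans; <-≤-trans; <⇒≤; <⇒≱; <⇒≯; ≤⇒≯; ≮⇒≥; ≤∧≢⇒<;
         n<1+n; m≤m+n; m<m+n; +-comm; +-suc; +-mono-≤; +-monoʳ-≤; ∸-monoˡ-≤; ∸-cancelʳ-≡;
         m+[n∸m]≡n; m∸n+n≡m; ⌈n/2⌉-mono; n≡⌈n+n/2⌉; <ᵇ-reflects-<; ≤ᵇ-reflects-≤;
         module ≤-Reasoning)
open import Data.Nat.Tactic.RingSolver using (solve-∀)
open import Data.Product using (Σ; _×_; _,_; proj₁; proj₂)
open import Data.Sum using (_⊎_; inj₁; inj₂)
import Data.Sum as Sum
open import Data.Vec using (tabulate; _∷_; [])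
open import Data.Vec.Properties using (lookup∘tabulate; []=⇒lookup; lookup⇒[]=; tabulate-cong)
open import Function using (_∘_)
open import Function.Bundles using (Injection)
open import Function.Properties.Inverse using (Inverse⇒Injection)
open import Level using (Level)
open import Relation.Binary.Definitions using (tri<; tri≈; tri>)
open import Relation.Binary.PropositionalEquality
  using (_≡_; _≢_; refl; sym; trans; cong; cong₂; subst; module ≡-Reasoning)
open import Relation.Nullary using (¬_; yes; no; contradiction; does; proof)
open import Relation.Nullary.Reflects using (Reflects; ofʸ; ofⁿ)

private
  variable
    ℓ : Level
    P : Set ℓ
    x y : Bool
    n : ℕ

reflects-true : Reflects P x → P → x ≡ true
reflects-true (ofʸ _)  _ = refl
reflects-true (ofⁿ ¬p) p = contradiction p ¬p

reflects-false : Reflects P x → ¬ P → x ≡ false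
reflects-false (ofʸ p) ¬p = contradiction p ¬p
reflects-false (ofⁿ _) _  = refl

reflects-true⁻ : Reflects P x → x ≡ true → P
reflects-true⁻ (ofʸ p) _ = p

reflects-false⁻ : Reflects P x → x ≡ false → ¬ P
reflects-false⁻ (ofⁿ ¬p) _ = ¬p

≡-from-≡true : (x ≡ true → y ≡ true) → (y ≡ true → x ≡ true) → x ≡ y
≡-from-≡true {false} {false} _ _ = refl
≡-from-≡true {false} {true}  _ y⇒x = y⇒x refl
≡-from-≡true {true}          x⇒y _ = sym (x⇒y refl)

∃-predecessor : ∀ {k m} → k < m → Σ ℕ λ r → m ≡ suc r × k ≤ r
∃-predecessor (s≤s k≤r) = _ , refl , k≤r

odd : ℕ → Bool
odd zero          = false
odd (suc zero)    = true
odd (suc (suc k)) = odd k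

odd-suc : ∀ k → odd (suc k) ≡ not (odd k)
odd-suc zero          = refl
odd-suc (suc zero)    = refl
odd-suc (suc (suc k)) = odd-suc k

⌈m+m+n/2⌉≡m+⌈n/2⌉ : ∀ k l → ⌈ k + k + l /2⌉ ≡ k + ⌈ l /2⌉
⌈m+m+n/2⌉≡m+⌈n/2⌉ zero    l = refl
⌈m+m+n/2⌉≡m+⌈n/2⌉ (suc k) l =
  trans (cong (λ x → ⌈ suc x + l /2⌉) (+-suc k k)) (cong suc (⌈m+m+n/2⌉≡m+⌈n/2⌉ k l))

∈-tabulate⁺ : ∀ {f : Fin n → Bool} {x} → f x ≡ true → x ∈ tabulate f
∈-tabulate⁺ {f = f} {x} fx = lookup⇒[]= x (tabulate f) (trans (lookup∘tabulate f x) fx)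

∈-tabulate⁻ : ∀ {f : Fin n → Bool} {x} → x ∈ tabulate f → f x ≡ true
∈-tabulate⁻ {f = f} {x} x∈ = trans (sym (lookup∘tabulate f x)) ([]=⇒lookup x∈)

∉-tabulate⁻ : ∀ {f : Fin n → Bool} {x} → x ∉ tabulate f → f x ≡ false
∉-tabulate⁻ {f = f} {x} x∉ with f x in fx
... | true  = contradiction (∈-tabulate⁺ fx) x∉
... | false = refl

∣p∣≡∣p∩q∣+∣p∩∁q∣ : ∀ (p q : Subset n) → ∣ p ∣ ≡ ∣ p ∩ q ∣ + ∣ p ∩ ∁ q ∣
∣p∣≡∣p∩q∣+∣p∩∁q∣ []          []          = refl
∣p∣≡∣p∩q∣+∣p∩∁q∣ (true ∷ p)  (true ∷ q)  = cong suc (∣p∣≡∣p∩q∣+∣p∩∁q∣ p q)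
∣p∣≡∣p∩q∣+∣p∩∁q∣ (true ∷ p)  (false ∷ q) =
  trans (cong suc (∣p∣≡∣p∩q∣+∣p∩∁q∣ p q)) (sym (+-suc _ _))
∣p∣≡∣p∩q∣+∣p∩∁q∣ (false ∷ p) (_ ∷ q)     = ∣p∣≡∣p∩q∣+∣p∩∁q∣ p q

∣p∣+∣∁p∣≡n : ∀ (p : Subset n) → ∣ p ∣ + ∣ ∁ p ∣ ≡ n
∣p∣+∣∁p∣≡n p = trans (cong (∣ p ∣ +_) (∣∁p∣≡n∸∣p∣ p)) (m+[n∸m]≡n (∣p∣≤n p))

p⊆q∧∣q∣≤∣p∣⇒q⊆p : ∀ {p q : Subset n} → p ⊆ q → ∣ q ∣ ≤ ∣ p ∣ → q ⊆ p
p⊆q∧∣q∣≤∣p∣⇒q⊆p {p = p} p⊆q ∣q∣≤∣p∣ {x} x∈q with x ∈? p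
... | yes x∈p = x∈p
... | no  x∉p = contradiction (p⊂q⇒∣p∣<∣q∣ (p⊆q , x , x∈q , x∉p)) (≤⇒≯ ∣q∣≤∣p∣)

subsingleton⇒∣p∣≤1 : ∀ {p : Subset n} → (∀ {x y} → x ∈ p → y ∈ p → x ≡ y) → ∣ p ∣ ≤ 1
subsingleton⇒∣p∣≤1 {n = n} {p = p} unique with nonempty? p
... | yes (x , x∈p) = ≤-trans (p⊆q⇒∣p∣≤∣q∣ p⊆⁅x⁆) (≤-reflexive (∣⁅x⁆∣≡1 x))
  where
  p⊆⁅x⁆ : p ⊆ ⁅ x ⁆
  p⊆⁅x⁆ y∈p = subst (_∈ ⁅ x ⁆) (unique x∈p y∈p) (x∈⁅x⁆ x)
... | no empty = ≤-trans (p⊆q⇒∣p∣≤∣q∣ p⊆⊥) (≤-trans (≤-reflexive (∣⊥∣≡0 n)) z≤n)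
  where
  p⊆⊥ : p ⊆ ⊥
  p⊆⊥ y∈p = contradiction (_ , y∈p) empty

pigeonhole : ∀ m (f : Fin n → ℕ) {p : Subset n} →
             (∀ {x} → x ∈ p → f x < m) →
             (∀ {x y} → x ∈ p → y ∈ p → f x ≡ f y → x ≡ y) →
             ∣ p ∣ ≤ m
pigeonhole {n = n} zero f {p} below _ = ≤-trans (p⊆q⇒∣p∣≤∣q∣ p⊆⊥) (≤-reflexive (∣⊥∣≡0 n))
  where
  p⊆⊥ : p ⊆ ⊥
  p⊆⊥ x∈p = contradiction (below x∈p) λ ()
pigeonhole (suc m) f {p} below injective = begin
  ∣ p ∣                           ≡⟨ ∣p∣≡∣p∩q∣+∣p∩∁q∣ p fibre ⟩
  ∣ p ∩ fibre ∣ + ∣ p ∩ ∁ fibre ∣ ≤⟨ +-mono-≤ (subsingleton⇒∣p∣≤1 fibre-unique)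
                                              (pigeonhole m f below′ injective′) ⟩
  1 + m                           ∎
  where
  open ≤-Reasoning
  fibre : Subset _
  fibre = tabulate (λ x → does (f x ≟ m))

  fibre-unique : ∀ {x y} → x ∈ p ∩ fibre → y ∈ p ∩ fibre → x ≡ y
  fibre-unique {x} {y} x∈ y∈ with x∈p , x∈fibre ← x∈p∩q⁻ p fibre x∈
                                | y∈p , y∈fibre ← x∈p∩q⁻ p fibre y∈ =
    injective x∈p y∈p (trans (reflects-true⁻ (proof (f x ≟ m)) (∈-tabulate⁻ x∈fibre))
                             (sym (reflects-true⁻ (proof (f y ≟ m)) (∈-tabulate⁻ y∈fibre))))

  below′ : ∀ {x} → x ∈ p ∩ ∁ fibre → f x < m
  below′ {x} x∈ with x∈p , x∈∁fibre ← x∈p∩q⁻ p (∁ fibre) x∈ =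
    ≤∧≢⇒< (s≤s⁻¹ (below x∈p))
          (reflects-false⁻ (proof (f x ≟ m)) (∉-tabulate⁻ (x∈∁p⇒x∉p x∈∁fibre)))

  injective′ : ∀ {x y} → x ∈ p ∩ ∁ fibre → y ∈ p ∩ ∁ fibre → f x ≡ f y → x ≡ y
  injective′ x∈ y∈ = injective (proj₁ (x∈p∩q⁻ p _ x∈)) (proj₁ (x∈p∩q⁻ p _ y∈))

countBelow : (ℕ → Bool) → ℕ → ℕ
countBelow f k = ∣ tabulate {n = k} (f ∘ toℕ) ∣

countBelow-+ : ∀ f k l → countBelow f (k + l) ≡ countBelow f k + countBelow (λ i → f (k + i)) l
countBelow-+ f zero    l = refl
countBelow-+ f (suc k) l with f 0
... | true  = cong suc (countBelow-+ (f ∘ suc) k l)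
... | false = countBelow-+ (f ∘ suc) k l

countBelow-all : ∀ {f} k → (∀ i → i < k → f i ≡ true) → countBelow f k ≡ k
countBelow-all zero       _   = refl
countBelow-all (suc k) all rewrite all 0 z<s =
  cong suc (countBelow-all k (λ i i<k → all (suc i) (s<s i<k)))

countBelow-none : ∀ {f} k → (∀ i → i < k → f i ≡ false) → countBelow f k ≡ 0
countBelow-none zero       _    = refl
countBelow-none (suc k) none rewrite none 0 z<s =
  countBelow-none k (λ i i<k → none (suc i) (s<s i<k))

countBelow-cong : ∀ {f g} k → (∀ i → i < k → f i ≡ g i) → countBelow f k ≡ countBelow g k
countBelow-cong k f≗g = cong ∣_∣ (tabulate-cong (λ i → f≗g (toℕ i) (toℕ<n i)))

countBelow-odd : ∀ k → countBelow odd k ≡ ⌊ k /2⌋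
countBelow-odd zero          = refl
countBelow-odd (suc zero)    = refl
countBelow-odd (suc (suc k)) = cong suc (countBelow-odd k)

-- Distances in graphs with a universal vertex

Universal : Graph n → Fin n → Set
Universal H c = ∀ z → z ≢ c → H c z ≡ true × H z c ≡ true

universal-mono : ∀ {G H : Graph n} {c} → SpanningSubgraph G H → Universal G c → Universal H c
universal-mono G⊆H universal z z≢c with cz , zc ← universal z z≢c = G⊆H _ z cz , G⊆H z _ zc

module _ {H : Graph n} where

  walk-zero : ∀ {u v} → Walk H u v 0 → u ≡ v
  walk-zero here = refl

  walk-one : ∀ {u v} → Walk H u v 1 → H u v ≡ true
  walk-one (step uv here) = uv

  dist-refl : ∀ {u} → Dist H u u 0
  dist-refl = here , λ _ ()

  dist-unique : ∀ {u v k l} → Dist H u v k → Dist H u v l → k ≡ l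
  dist-unique {k = k} {l} (walk-k , shortest-k) (walk-l , shortest-l) with <-cmp k l
  ... | tri< k<l _ _ = contradiction walk-k (shortest-l k k<l)
  ... | tri≈ _ k≡l _ = k≡l
  ... | tri> _ _ l<k = contradiction walk-l (shortest-k l l<k)

adjacencyDistance : Bool → ℕ
adjacencyDistance true  = 1
adjacencyDistance false = 2

adjacencyDistance-injective : adjacencyDistance x ≡ adjacencyDistance y → x ≡ y
adjacencyDistance-injective {false} {false} _ = refl
adjacencyDistance-injective {true}  {true}  _ = refl

universal⇒dist : ∀ {H : Graph n} {c u v} → Universal H c → u ≢ v →
                 Dist H u v (adjacencyDistance (H u v))
universal⇒dist {H = H} {c} {u} {v} universal u≢v with H u v in uv
... | true  = step uv here , λ { zero _ walk → u≢v (walk-zero walk) ; (suc _) (s≤s ()) }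
... | false = step (proj₂ (universal u u≢c)) (step (proj₁ (universal v v≢c)) here) , shorter
  where
  u≢c : u ≢ c
  u≢c refl = contradiction (trans (sym uv) (proj₁ (universal v (u≢v ∘ sym)))) λ ()
  v≢c : v ≢ c
  v≢c refl = contradiction (trans (sym uv) (proj₂ (universal u u≢v))) λ ()
  shorter : ∀ j → j < 2 → ¬ Walk H u v j
  shorter zero       _ walk = u≢v (walk-zero walk)
  shorter (suc zero) _ walk = contradiction (trans (sym uv) (walk-one walk)) λ ()
  shorter (suc (suc _)) (s≤s (s≤s ()))

AdjacencySeparating : Graph n → Subset n → Set
AdjacencySeparating {n} H W =
  ∀ {u v : Fin n} → u ∉ W → v ∉ W → (∀ {w} → w ∈ W → H u w ≡ H v w) → u ≡ v

∉∧∈⇒≢ : ∀ {W : Subset n} {u w} → u ∉ W → w ∈ W → u ≢ w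
∉∧∈⇒≢ u∉W w∈W refl = u∉W w∈W

module _ {H : Graph n} {c : Fin n} (universal : Universal H c) {W : Subset n} where

  resolving⇒adjacencySeparating : Resolving H W → AdjacencySeparating H W
  resolving⇒adjacencySeparating resolving {u} {v} u∉W v∉W same =
    resolving u v λ w w∈W _ →
      transfer u∉W v∉W w∈W (same w∈W) , transfer v∉W u∉W w∈W (sym (same w∈W))
    where
    transfer : ∀ {x y w k} → x ∉ W → y ∉ W → w ∈ W → H x w ≡ H y w → Dist H x w k → Dist H y w k
    transfer {x} {y} {w} x∉W y∉W w∈W xw≡yw dist =
      subst (Dist H y w)
            (sym (trans (dist-unique dist (universal⇒dist universal (∉∧∈⇒≢ x∉W w∈W)))
                        (cong adjacencyDistance xw≡yw)))
            (universal⇒dist universal (∉∧∈⇒≢ y∉W w∈W))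

  adjacencySeparating⇒resolving : AdjacencySeparating H W → Resolving H W
  adjacencySeparating⇒resolving separating u v profile with u ∈? W | v ∈? W
  ... | yes u∈W | _       = sym (walk-zero (proj₁ (proj₁ (profile u u∈W 0) dist-refl)))
  ... | no _    | yes v∈W = walk-zero (proj₁ (proj₂ (profile v v∈W 0) dist-refl))
  ... | no u∉W  | no v∉W  = separating u∉W v∉W λ {w} w∈W →
    let u≢w = ∉∧∈⇒≢ u∉W w∈W
        v≢w = ∉∧∈⇒≢ v∉W w∈W
    in adjacencyDistance-injective
         (dist-unique (proj₁ (profile w w∈W _) (universal⇒dist universal u≢w))
                      (universal⇒dist universal v≢w))

-- Threshold graphs

codeGraph-mono : ∀ {b b′ : Code n} → (∀ i → b i ≡ true → b′ i ≡ true) →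
                 SpanningSubgraph (codeGraph b) (codeGraph b′)
codeGraph-mono b⇒b′ i j with toℕ i <ᵇ toℕ j | toℕ j <ᵇ toℕ i
... | true  | _     = b⇒b′ j
... | false | true  = b⇒b′ i
... | false | false = λ ()

VicinallyBelow : Graph n → Fin n → Fin n → Set
VicinallyBelow H u v = ∀ z → z ≢ u → z ≢ v → H u z ≡ true → H v z ≡ true

VicinallyTotal : Graph n → Set
VicinallyTotal H = ∀ u v → VicinallyBelow H u v ⊎ VicinallyBelow H v u

module _ (b : Code n) where

  codeGraph-< : ∀ {i j} → toℕ i < toℕ j → codeGraph b i j ≡ b j
  codeGraph-< {i} {j} i<j rewrite reflects-true (<ᵇ-reflects-< (toℕ i) (toℕ j)) i<j = refl

  codeGraph-> : ∀ {i j} → toℕ j < toℕ i → codeGraph b i j ≡ b i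
  codeGraph-> {i} {j} j<i
    rewrite reflects-false (<ᵇ-reflects-< (toℕ i) (toℕ j)) (<⇒≯ j<i)
          | reflects-true (<ᵇ-reflects-< (toℕ j) (toℕ i)) j<i = refl

  codeGraph-universal : ∀ m → (∀ z → m ≤ toℕ z → b z ≡ true) →
                        ∀ {c} → m ≤ toℕ c → Universal (codeGraph b) c
  codeGraph-universal m dominating {c} m≤c z z≢c with <-cmp (toℕ z) (toℕ c)
  ... | tri< z<c _ _ = trans (codeGraph-> z<c) bc , trans (codeGraph-< z<c) bc
    where
    bc : b c ≡ true
    bc = dominating c m≤c
  ... | tri≈ _ z≡c _ = contradiction (toℕ-injective z≡c) z≢c
  ... | tri> _ _ c<z = trans (codeGraph-< c<z) bz , trans (codeGraph-> c<z) bz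
    where
    bz : b z ≡ true
    bz = dominating z (≤-trans m≤c (<⇒≤ c<z))

  codeGraph-beyond : ∀ {p q z} → toℕ p < toℕ z → toℕ q < toℕ z → codeGraph b p z ≡ codeGraph b q z
  codeGraph-beyond p<z q<z = trans (codeGraph-< p<z) (sym (codeGraph-< q<z))

  later-dominating⇒below : ∀ {p q} → toℕ p < toℕ q → b q ≡ true → VicinallyBelow (codeGraph b) p q
  later-dominating⇒below {p} {q} p<q bq z _ z≢q pz with <-cmp (toℕ z) (toℕ q)
  ... | tri< z<q _ _ = trans (codeGraph-> z<q) bq
  ... | tri≈ _ z≡q _ = contradiction (toℕ-injective z≡q) z≢q
  ... | tri> _ _ q<z = trans (sym (codeGraph-beyond (<-trans p<q q<z) q<z)) pz

  later-isolated⇒above : ∀ {p q} → toℕ p < toℕ q → b q ≡ false → VicinallyBelow (codeGraph b) q p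
  later-isolated⇒above {p} {q} p<q bq z z≢q _ qz with <-cmp (toℕ z) (toℕ q)
  ... | tri< z<q _ _ = contradiction (trans (sym qz) (trans (codeGraph-> z<q) bq)) λ ()
  ... | tri≈ _ z≡q _ = contradiction (toℕ-injective z≡q) z≢q
  ... | tri> _ _ q<z = trans (codeGraph-beyond (<-trans p<q q<z) q<z) qz

  codeGraph-comparable : ∀ {p q} → toℕ p < toℕ q →
                         VicinallyBelow (codeGraph b) p q ⊎ VicinallyBelow (codeGraph b) q p
  codeGraph-comparable {p} {q} p<q = by-bit (b q) refl
    where
    by-bit : ∀ x → b q ≡ x → VicinallyBelow (codeGraph b) p q ⊎ VicinallyBelow (codeGraph b) q p
    by-bit true  bq = inj₁ (later-dominating⇒below p<q bq)
    by-bit false bq = inj₂ (later-isolated⇒above p<q bq)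

  codeGraph-vicinallyTotal : VicinallyTotal (codeGraph b)
  codeGraph-vicinallyTotal p q with <-cmp (toℕ p) (toℕ q)
  ... | tri< p<q _ _ = codeGraph-comparable p<q
  ... | tri≈ _ p≡q _ rewrite toℕ-injective p≡q = inj₁ λ _ _ _ qz → qz
  ... | tri> _ _ q<p = Sum.swap (codeGraph-comparable q<p)

threshold-vicinallyTotal : ∀ {H : Graph n} → IsThreshold H → VicinallyTotal H
threshold-vicinallyTotal {H = H} (b , σ , H≡) u v =
  Sum.map transport transport (codeGraph-vicinallyTotal b (σ ⟨$⟩ʳ u) (σ ⟨$⟩ʳ v))
  where
  σ-injective : ∀ {x y} → σ ⟨$⟩ʳ x ≡ σ ⟨$⟩ʳ y → x ≡ y
  σ-injective = Injection.injective (Inverse⇒Injection σ)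
  transport : ∀ {x y} → VicinallyBelow (codeGraph b) (σ ⟨$⟩ʳ x) (σ ⟨$⟩ʳ y) → VicinallyBelow H x y
  transport {x} {y} below z z≢x z≢y xz =
    trans (H≡ y z)
          (below (σ ⟨$⟩ʳ z) (z≢x ∘ σ-injective) (z≢y ∘ σ-injective) (trans (sym (H≡ x z)) xz))

-- A lower bound for resolving sets

module _ {H : Graph n} {W : Subset n} where

  trace : Fin n → Subset n
  trace u = W ∩ tabulate (H u)

  ∈-trace⁺ : ∀ {u w} → w ∈ W → H u w ≡ true → w ∈ trace u
  ∈-trace⁺ w∈W uw = x∈p∩q⁺ (w∈W , ∈-tabulate⁺ uw)

  ∈-trace⁻ : ∀ {u w} → w ∈ trace u → w ∈ W × H u w ≡ true
  ∈-trace⁻ w∈ with w∈W , w∈N ← x∈p∩q⁻ W _ w∈ = w∈W , ∈-tabulate⁻ w∈N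

  below∧∣trace∣≡⇒≡ : AdjacencySeparating H W → ∀ {u v} → VicinallyBelow H u v →
                     u ∉ W → v ∉ W → ∣ trace u ∣ ≡ ∣ trace v ∣ → u ≡ v
  below∧∣trace∣≡⇒≡ separating {u} {v} below u∉W v∉W same-size =
    separating u∉W v∉W λ w∈W →
      ≡-from-≡true (λ uw → proj₂ (∈-trace⁻ (u⊆v (∈-trace⁺ w∈W uw))))
                   (λ vw → proj₂ (∈-trace⁻ (v⊆u (∈-trace⁺ w∈W vw))))
    where
    u⊆v : trace u ⊆ trace v
    u⊆v w∈ with w∈W , uw ← ∈-trace⁻ w∈ =
      ∈-trace⁺ w∈W (below _ (∉∧∈⇒≢ u∉W w∈W ∘ sym) (∉∧∈⇒≢ v∉W w∈W ∘ sym) uw)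
    v⊆u : trace v ⊆ trace u
    v⊆u = p⊆q∧∣q∣≤∣p∣⇒q⊆p u⊆v (≤-reflexive (sym same-size))

  ∣trace∣-injective : VicinallyTotal H → AdjacencySeparating H W →
                      ∀ {u v} → u ∉ W → v ∉ W → ∣ trace u ∣ ≡ ∣ trace v ∣ → u ≡ v
  ∣trace∣-injective total separating {u} {v} u∉W v∉W same-size with total u v
  ... | inj₁ below = below∧∣trace∣≡⇒≡ separating below u∉W v∉W same-size
  ... | inj₂ above = sym (below∧∣trace∣≡⇒≡ separating above v∉W u∉W (sym same-size))

  module _ {U : Subset n} (universal : ∀ {z} → z ∈ U → Universal H z) where

    ∣U∩∁W∣≤1 : AdjacencySeparating H W → ∣ U ∩ ∁ W ∣ ≤ 1
    ∣U∩∁W∣≤1 separating = subsingleton⇒∣p∣≤1 λ {x} {y} x∈ y∈ →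
      separating (outside x∈) (outside y∈) λ w∈W →
        trans (adjacent x∈ w∈W) (sym (adjacent y∈ w∈W))
      where
      outside : ∀ {x} → x ∈ U ∩ ∁ W → x ∉ W
      outside x∈ = x∈∁p⇒x∉p (proj₂ (x∈p∩q⁻ U _ x∈))
      adjacent : ∀ {x w} → x ∈ U ∩ ∁ W → w ∈ W → H x w ≡ true
      adjacent x∈ w∈W = proj₁ (universal (proj₁ (x∈p∩q⁻ U _ x∈)) _ (∉∧∈⇒≢ (outside x∈) w∈W ∘ sym))

    ∣∁W∣≤1+∣W∣∸∣U∩W∣ : VicinallyTotal H → AdjacencySeparating H W →
                        ∣ ∁ W ∣ ≤ suc (∣ W ∣ ∸ ∣ U ∩ W ∣)
    ∣∁W∣≤1+∣W∣∸∣U∩W∣ total separating =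
      pigeonhole _ (λ u → ∣ trace u ∣ ∸ ∣ U ∩ W ∣) bounded injective
      where
      U∩W⊆trace : ∀ {u} → u ∉ W → U ∩ W ⊆ trace u
      U∩W⊆trace u∉W w∈ with w∈U , w∈W ← x∈p∩q⁻ U W w∈ =
        ∈-trace⁺ w∈W (proj₂ (universal w∈U _ (∉∧∈⇒≢ u∉W w∈W)))
      bounded : ∀ {u} → u ∈ ∁ W → ∣ trace u ∣ ∸ ∣ U ∩ W ∣ < suc (∣ W ∣ ∸ ∣ U ∩ W ∣)
      bounded {u} _ = s≤s (∸-monoˡ-≤ ∣ U ∩ W ∣ (p⊆q⇒∣p∣≤∣q∣ (p∩q⊆p W (tabulate (H u)))))
      injective : ∀ {u v} → u ∈ ∁ W → v ∈ ∁ W →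
                  ∣ trace u ∣ ∸ ∣ U ∩ W ∣ ≡ ∣ trace v ∣ ∸ ∣ U ∩ W ∣ → u ≡ v
      injective u∈ v∈ same =
        ∣trace∣-injective total separating (x∈∁p⇒x∉p u∈) (x∈∁p⇒x∉p v∈)
          (∸-cancelʳ-≡ (p⊆q⇒∣p∣≤∣q∣ (U∩W⊆trace (x∈∁p⇒x∉p u∈)))
                       (p⊆q⇒∣p∣≤∣q∣ (U∩W⊆trace (x∈∁p⇒x∉p v∈))) same)

    resolving-lowerBound : VicinallyTotal H → ∀ {c} → c ∈ U → Resolving H W →
                           n + ∣ U ∣ ≤ 2 + (∣ W ∣ + ∣ W ∣)
    resolving-lowerBound total c∈U resolving = begin
      n + ∣ U ∣
        ≡⟨ cong₂ _+_ (sym (∣p∣+∣∁p∣≡n W)) (∣p∣≡∣p∩q∣+∣p∩∁q∣ U W) ⟩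
      (∣ W ∣ + ∣ ∁ W ∣) + (∣ U ∩ W ∣ + ∣ U ∩ ∁ W ∣)
        ≤⟨ +-mono-≤ (+-monoʳ-≤ ∣ W ∣ (∣∁W∣≤1+∣W∣∸∣U∩W∣ total separating))
                    (+-monoʳ-≤ ∣ U ∩ W ∣ (∣U∩∁W∣≤1 separating)) ⟩
      (∣ W ∣ + suc (∣ W ∣ ∸ ∣ U ∩ W ∣)) + (∣ U ∩ W ∣ + 1)
        ≡⟨ rearrange ∣ W ∣ _ _ ⟩
      2 + (∣ W ∣ + (∣ W ∣ ∸ ∣ U ∩ W ∣ + ∣ U ∩ W ∣))
        ≡⟨ cong (λ x → 2 + (∣ W ∣ + x)) (m∸n+n≡m (∣p∩q∣≤∣q∣ U W)) ⟩
      2 + (∣ W ∣ + ∣ W ∣)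
        ∎
      where
      open ≤-Reasoning
      separating : AdjacencySeparating H W
      separating = resolving⇒adjacencySeparating (universal c∈U) resolving
      rearrange : ∀ x d y → (x + suc d) + (y + 1) ≡ 2 + (x + (d + y))
      rearrange = solve-∀

-- A threshold supergraph with a small resolving set

alternatingCode : ℕ → Code n
alternatingCode s i = (s ≤ᵇ toℕ i) ∨ not (odd (toℕ i))

oddOrBeyond : ℕ → Subset n
oddOrBeyond s = tabulate λ i → (s <ᵇ toℕ i) ∨ odd (toℕ i)

∉-oddOrBeyond : ∀ {s} {v : Fin n} → v ∉ oddOrBeyond s → toℕ v ≤ s × odd (toℕ v) ≡ false
∉-oddOrBeyond {s = s} {v} v∉W =
  ≮⇒≥ (reflects-false⁻ (<ᵇ-reflects-< s (toℕ v)) (∨-conicalˡ _ _ v∉W′)) , ∨-conicalʳ _ _ v∉W′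
  where
  v∉W′ : (s <ᵇ toℕ v) ∨ odd (toℕ v) ≡ false
  v∉W′ = ∉-tabulate⁻ v∉W

module _ {n : ℕ} (s : ℕ) where

  private
    H : Graph n
    H = codeGraph (alternatingCode s)
    W : Subset n
    W = oddOrBeyond s

  predecessor-separates : ∀ {u v} → u ∉ W → v ∉ W → toℕ u < toℕ v →
                          ¬ (∀ {w} → w ∈ W → H u w ≡ H v w)
  predecessor-separates {u} {v} u∉W v∉W u<v same with r , v≡1+r , u≤r ← ∃-predecessor u<v =
    contradiction (trans (sym uw) (trans (same w∈W) vw)) λ ()
    where
    v≤s : toℕ v ≤ s
    v≤s = proj₁ (∉-oddOrBeyond v∉W)
    v-even : odd (toℕ v) ≡ false
    v-even = proj₂ (∉-oddOrBeyond v∉W)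
    r-odd : odd r ≡ true
    r-odd = not-injective (trans (sym (odd-suc r)) (trans (cong odd (sym v≡1+r)) v-even))
    r<v : r < toℕ v
    r<v = subst (r <_) (sym v≡1+r) (n<1+n r)
    r<n : r < n
    r<n = <-trans r<v (toℕ<n v)
    w : Fin n
    w = fromℕ< r<n
    w≡r : toℕ w ≡ r
    w≡r = toℕ-fromℕ< r<n
    w∈W : w ∈ W
    w∈W = ∈-tabulate⁺ (trans (cong (λ i → (s <ᵇ i) ∨ odd i) w≡r)
                             (trans (cong ((s <ᵇ r) ∨_) r-odd) (∨-zeroʳ _)))
    u<w : toℕ u < toℕ w
    u<w = ≤∧≢⇒< (subst (toℕ u ≤_) (sym w≡r) u≤r)
                (λ u≡w → u∉W (subst (_∈ W) (sym (toℕ-injective u≡w)) w∈W))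
    w<v : toℕ w < toℕ v
    w<v = subst (_< toℕ v) (sym w≡r) r<v
    uw : H u w ≡ false
    uw = trans (codeGraph-< (alternatingCode s) u<w)
               (trans (cong (λ i → (s ≤ᵇ i) ∨ not (odd i)) w≡r)
                      (cong₂ _∨_ (reflects-false (≤ᵇ-reflects-≤ s r) (<⇒≱ (<-≤-trans r<v v≤s)))
                                 (cong not r-odd)))
    vw : H v w ≡ true
    vw = trans (codeGraph-> (alternatingCode s) w<v)
               (trans (cong (λ x → (s ≤ᵇ toℕ v) ∨ not x) v-even) (∨-zeroʳ _))

  oddOrBeyond-separating : AdjacencySeparating H W
  oddOrBeyond-separating {u} {v} u∉W v∉W same with <-cmp (toℕ u) (toℕ v)
  ... | tri< u<v _ _ = ⊥-elim (predecessor-separates u∉W v∉W u<v same)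
  ... | tri≈ _ u≡v _ = toℕ-injective u≡v
  ... | tri> _ _ v<u = ⊥-elim (predecessor-separates v∉W u∉W v<u (sym ∘ same))

∣oddOrBeyond∣ : ∀ s t → 1 ≤ t → ∣ oddOrBeyond {n = s + t} s ∣ ≡ ⌈ s /2⌉ + (t ∸ 1)
∣oddOrBeyond∣ s (suc t) _ = begin
  countBelow f (s + suc t)
    ≡⟨ cong (countBelow f) (+-suc s t) ⟩
  countBelow f (suc s + t)
    ≡⟨ countBelow-+ f (suc s) t ⟩
  countBelow f (suc s) + countBelow (λ i → f (suc s + i)) t
    ≡⟨ cong₂ _+_ (countBelow-cong (suc s) up-to-s) (countBelow-all t beyond-s) ⟩
  countBelow odd (suc s) + t
    ≡⟨ cong (_+ t) (countBelow-odd (suc s)) ⟩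
  ⌈ s /2⌉ + t
    ∎
  where
  open ≡-Reasoning
  f : ℕ → Bool
  f i = (s <ᵇ i) ∨ odd i
  up-to-s : ∀ i → i < suc s → f i ≡ odd i
  up-to-s i i≤s rewrite reflects-false (<ᵇ-reflects-< s i) (≤⇒≯ (s≤s⁻¹ i≤s)) = refl
  beyond-s : ∀ i → i < t → f (suc s + i) ≡ true
  beyond-s i _ rewrite reflects-true (<ᵇ-reflects-< s (suc s + i)) (s≤s (m≤m+n s i)) = refl

s+t+t≤2+A+A⇒⌈s/2⌉+t∸1≤A : ∀ s {t A} → 1 ≤ t → s + t + t ≤ 2 + (A + A) → ⌈ s /2⌉ + (t ∸ 1) ≤ A
s+t+t≤2+A+A⇒⌈s/2⌉+t∸1≤A s {suc t} {A} _ s+t+t≤2+A+A = begin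
  ⌈ s /2⌉ + t     ≡⟨ +-comm ⌈ s /2⌉ t ⟩
  t + ⌈ s /2⌉     ≡⟨ sym (⌈m+m+n/2⌉≡m+⌈n/2⌉ t s) ⟩
  ⌈ t + t + s /2⌉ ≤⟨ ⌈n/2⌉-mono t+t+s≤A+A ⟩
  ⌈ A + A /2⌉     ≡⟨ sym (n≡⌈n+n/2⌉ A) ⟩
  A               ∎
  where
  open ≤-Reasoning
  rearrange : ∀ s t → s + suc t + suc t ≡ 2 + (t + t + s)
  rearrange = solve-∀
  t+t+s≤A+A : t + t + s ≤ A + A
  t+t+s≤A+A = s≤s⁻¹ (s≤s⁻¹ (subst (_≤ 2 + (A + A)) (rearrange s t) s+t+t≤2+A+A))

module _ (s t : ℕ) (t≥1 : 1 ≤ t) where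

  private
    G : Graph (s + t)
    G = codeGraph (code0s1t s t)

    s<s+t : s < s + t
    s<s+t = m<m+n s t≥1

    c : Fin (s + t)
    c = fromℕ< s<s+t

    s≤c : s ≤ toℕ c
    s≤c = ≤-reflexive (sym (toℕ-fromℕ< s<s+t))

  lower-bound : ∀ (H : Graph (s + t)) → IsThreshold H → SpanningSubgraph G H →
                ∀ W → Resolving H W → ⌈ s /2⌉ + (t ∸ 1) ≤ ∣ W ∣
  lower-bound H threshold G⊆H W resolving = s+t+t≤2+A+A⇒⌈s/2⌉+t∸1≤A s t≥1 (begin
    s + t + t     ≡⟨ cong (s + t +_) (sym ∣U∣≡t) ⟩
    s + t + ∣ U ∣ ≤⟨ resolving-lowerBound U-universal (threshold-vicinallyTotal threshold)
                                          c∈U resolving ⟩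
    2 + (∣ W ∣ + ∣ W ∣) ∎)
    where
    open ≤-Reasoning
    U : Subset (s + t)
    U = tabulate (code0s1t s t)
    U-universal : ∀ {z} → z ∈ U → Universal H z
    U-universal z∈U =
      universal-mono G⊆H
        (codeGraph-universal (code0s1t s t) s
           (λ z s≤z → reflects-true (≤ᵇ-reflects-≤ s (toℕ z)) s≤z)
           (reflects-true⁻ (≤ᵇ-reflects-≤ s _) (∈-tabulate⁻ z∈U)))
    c∈U : c ∈ U
    c∈U = ∈-tabulate⁺ (reflects-true (≤ᵇ-reflects-≤ s (toℕ c)) s≤c)
    ∣U∣≡t : ∣ U ∣ ≡ t
    ∣U∣≡t = begin-equality
      countBelow (s ≤ᵇ_) (s + t)                             ≡⟨ countBelow-+ (s ≤ᵇ_) s t ⟩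
      countBelow (s ≤ᵇ_) s + countBelow (λ i → s ≤ᵇ s + i) t ≡⟨ cong₂ _+_
           (countBelow-none s (λ i i<s → reflects-false (≤ᵇ-reflects-≤ s i) (<⇒≱ i<s)))
           (countBelow-all t (λ i _ → reflects-true (≤ᵇ-reflects-≤ s (s + i)) (m≤m+n s i))) ⟩
      t ∎

  upper-bound : Σ (Graph (s + t)) λ H → IsThreshold H × SpanningSubgraph G H ×
                  Σ (Subset (s + t)) λ W → Resolving H W × ∣ W ∣ ≡ ⌈ s /2⌉ + (t ∸ 1)
  upper-bound = codeGraph code , (code , id , λ _ _ → refl) , codeGraph-mono G⊆H
              , oddOrBeyond s , resolving , ∣oddOrBeyond∣ s t t≥1
    where
    code : Code (s + t)
    code = alternatingCode s
    G⊆H : ∀ i → code0s1t s t i ≡ true → code i ≡ true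
    G⊆H i bit = cong (_∨ not (odd (toℕ i))) bit
    resolving : Resolving (codeGraph code) (oddOrBeyond s)
    resolving = adjacencySeparating⇒resolving
      (codeGraph-universal code s
         (λ z s≤z → G⊆H z (reflects-true (≤ᵇ-reflects-≤ s (toℕ z)) s≤z)) s≤c)
      (oddOrBeyond-separating s)

proposition3p6 : (s t : ℕ) → 4 ≤ s → 1 ≤ t →
    RestrictedThresholdDim (codeGraph (code0s1t s t)) (⌈ s /2⌉ + (t ∸ 1))
proposition3p6 s t _ t≥1 = upper-bound s t t≥1 , lower-bound s t t≥1
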